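{- For all integers $a \geq 2$ and all integers $k \geq \frac{a^2}{a+1}+2$, $dor_k(a) \leq 3$; that is, there is a $4$-coloring of $\mathbf{N}$ containing no monochromatic $k$-term $a$-progression.
   Context: $\mathbf{N}=\{1,2,3,\dots\}$. For integers $a \geq 1$ and $k \geq 3$, a $k$-term $a$-progression is a set of the form $\{x,ax+d,ax+2d,\dots,ax+(k-1)d\}$ with $x,d \in \mathbf{N}$. $dor_k(a)$ denotes the largest number $r$ of colors such that every $r$-coloring of $\mathbf{N}$ contains a monochromatic $k$-term $a$-progression. -}

module Defs where

open import Data.Nat using (ℕ; zero; suc; _+_; _*_; _∸_; _≤_; _<_)
open import Data.Fin using (Fin)
open import Relation.Binary.PropositionalEquality using (_≡_)

-- The i-th element (i ≥ 1) of the a-progression {x, ax+d, ..., ax+(k-1)d}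
-- is a*x + i*d ; the 0-th element is x.

-- A coloring of N = {1,2,3,...} with r colors: values at 0 are irrelevant
-- since only positive integers are ever inspected below.
Coloring : ℕ → Set
Coloring r = ℕ → Fin r

MonoProg : {r : ℕ} → Coloring r → (k a x d : ℕ) → Set
MonoProg c k a x d = ∀ i → 1 ≤ i → i < k → c (a * x + i * d) ≡ c x

HasMonoProg : {r : ℕ} → Coloring r → (k a : ℕ) → Set
HasMonoProg c k a = ∃x-d
  where
  open import Data.Product using (Σ; _×_)
  ∃x-d = Σ ℕ λ x → Σ ℕ λ d → (1 ≤ x) × (1 ≤ d) × MonoProg c k a x d

-- Colour n by ⌊log_a n⌋ mod 4. Along a monochromatic progression ax + d, ..., ax + (k-1)d
-- consecutive terms differ by at most the smaller one, so ⌊log_a⌋ rises by at most 1 per step;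
-- a rise of 1 would change the colour, hence all these terms lie in one block [a^j, a^(j+1)).
-- The first term x has the same colour and a smaller logarithm, so it lies at least four blocks
-- lower: a³x ≤ a^j. Then d ≥ a^j - ax is so large that once a² ≤ (k-2)(a+1) the progression
-- leaves the block before its last term.
module Submission where

open import Defs
open import Data.Nat using (ℕ; _+_; _*_; _∸_; _≤_)
open import Data.Product using (Σ)
open import Relation.Nullary using (¬_)
open import Data.Nat using (zero; suc; _<_; _^_; z≤n; s≤s; s≤s⁻¹; z<s; _<?_; NonZero; >-nonZero)
open import Data.Nat.Properties
open import Data.Nat.Tactic.RingSolver using (solve-∀)
open import Data.Fin using (Fin)
open import Data.Product using (_,_; proj₁; proj₂; _×_; ∃-syntax)
open import Data.Sum using (_⊎_; inj₁; inj₂)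
open import Relation.Nullary using (yes; no; contradiction)
open import Relation.Binary.PropositionalEquality

next : Fin 4 → Fin 4
next Fin.zero = Fin.suc Fin.zero
next (Fin.suc Fin.zero) = Fin.suc (Fin.suc Fin.zero)
next (Fin.suc (Fin.suc Fin.zero)) = Fin.suc (Fin.suc (Fin.suc Fin.zero))
next (Fin.suc (Fin.suc (Fin.suc Fin.zero))) = Fin.zero

cycle : ℕ → Fin 4
cycle zero = Fin.zero
cycle (suc n) = next (cycle n)

next-aperiodic : ∀ c → next c ≢ c × next (next c) ≢ c × next (next (next c)) ≢ c
next-aperiodic Fin.zero = (λ ()) , (λ ()) , (λ ())
next-aperiodic (Fin.suc Fin.zero) = (λ ()) , (λ ()) , (λ ())
next-aperiodic (Fin.suc (Fin.suc Fin.zero)) = (λ ()) , (λ ()) , (λ ())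
next-aperiodic (Fin.suc (Fin.suc (Fin.suc Fin.zero))) = (λ ()) , (λ ()) , (λ ())

cycle-shift : ∀ r n → cycle (r + n) ≡ cycle n → r ≡ 0 ⊎ 4 ≤ r
cycle-shift 0 n _ = inj₁ refl
cycle-shift 1 n eq = contradiction eq (proj₁ (next-aperiodic (cycle n)))
cycle-shift 2 n eq = contradiction eq (proj₁ (proj₂ (next-aperiodic (cycle n))))
cycle-shift 3 n eq = contradiction eq (proj₂ (proj₂ (next-aperiodic (cycle n))))
cycle-shift (suc (suc (suc (suc r)))) n _ = inj₂ (s≤s (s≤s (s≤s (s≤s z≤n))))

cycle-≡⇒≡⊎4+≤ : ∀ {p q} → p ≤ q → cycle p ≡ cycle q → p ≡ q ⊎ 4 + p ≤ q
cycle-≡⇒≡⊎4+≤ {p} {q} p≤q eq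
  with cycle-shift (q ∸ p) p (trans (cong cycle (m∸n+n≡m p≤q)) (sym eq))
... | inj₁ r≡0 = inj₁ (trans (cong (_+ p) (sym r≡0)) (m∸n+n≡m p≤q))
... | inj₂ 4≤r = inj₂ (subst (4 + p ≤_) (m∸n+n≡m p≤q) (+-monoˡ-≤ p 4≤r))

cycle-≡⇒≡ : ∀ {p q} → p ≤ q → q ≤ suc p → cycle p ≡ cycle q → p ≡ q
cycle-≡⇒≡ {p} p≤q q≤1+p eq with cycle-≡⇒≡⊎4+≤ p≤q eq
... | inj₁ p≡q = p≡q
... | inj₂ 4+p≤q =
  contradiction (≤-trans 4+p≤q q≤1+p) (<⇒≱ (+-monoˡ-< p (s≤s (s≤s z≤n))))

cycle-≡⇒4+≤ : ∀ {p q} → p < q → cycle p ≡ cycle q → 4 + p ≤ q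
cycle-≡⇒4+≤ p<q eq with cycle-≡⇒≡⊎4+≤ (<⇒≤ p<q) eq
... | inj₁ p≡q = contradiction p≡q (<⇒≢ p<q)
... | inj₂ 4+p≤q = 4+p≤q

-- The identity is (a - 1)(a + 1) + 1 = a², with a - 1 written as e.
cubic-bound : ∀ {a m} → 1 ≤ a → a * a ≤ m * (a + 1) → a * (a * a) + m ≤ m * (a * a) + a * a
cubic-bound {a@(suc e)} {m} _ a²≤m[a+1] = begin
  a * Q + m                    ≡⟨ +-assoc Q (e * Q) m ⟩
  Q + (e * Q + m)              ≤⟨ +-monoʳ-≤ Q (+-monoˡ-≤ m (*-monoʳ-≤ e a²≤m[a+1])) ⟩
  Q + (e * (m * (a + 1)) + m)  ≡⟨ cong (Q +_) (identity e m) ⟩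
  Q + m * Q                    ≡⟨ +-comm Q (m * Q) ⟩
  m * Q + Q                    ∎
  where
  open ≤-Reasoning
  Q : ℕ
  Q = a * a
  identity : ∀ e m → e * (m * (suc e + 1)) + m ≡ m * (suc e * suc e)
  identity = solve-∀

progression-leaves-block : ∀ a m {A X D} → a * a ≤ m * (a + 1) → A ≤ X + D → a * a * X ≤ A →
                           a * A ≤ X + suc m * D
progression-leaves-block zero m _ _ _ = z≤n
progression-leaves-block a@(suc _) m {A} {X} {D} a²≤m[a+1] A≤X+D a²X≤A =
  *-cancelˡ-≤ Q (+-cancelʳ-≤ (m * (Q * X)) _ _ (begin
    Q * (a * A) + m * (Q * X)          ≤⟨ +-monoʳ-≤ (Q * (a * A)) (*-monoʳ-≤ m a²X≤A) ⟩
    Q * (a * A) + m * A                ≡⟨ regroup₁ Q a A m ⟩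
    (a * Q + m) * A                    ≤⟨ *-monoˡ-≤ A (cubic-bound {a} z<s a²≤m[a+1]) ⟩
    (m * Q + Q) * A                    ≡⟨ regroup₂ Q m A ⟩
    suc m * (Q * A)                    ≤⟨ *-monoʳ-≤ (suc m) (*-monoʳ-≤ Q A≤X+D) ⟩
    suc m * (Q * (X + D))              ≡⟨ regroup₃ Q m X D ⟩
    Q * (X + suc m * D) + m * (Q * X)  ∎))
  where
  open ≤-Reasoning
  Q : ℕ
  Q = a * a
  regroup₁ : ∀ Q a A m → Q * (a * A) + m * A ≡ (a * Q + m) * A
  regroup₁ = solve-∀
  regroup₂ : ∀ Q m A → (m * Q + Q) * A ≡ suc m * (Q * A)
  regroup₂ = solve-∀
  regroup₃ : ∀ Q m X D → suc m * (Q * (X + D)) ≡ Q * (X + suc m * D) + m * (Q * X)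
  regroup₃ = solve-∀

^-cancelˡ-< : ∀ a .{{_ : NonZero a}} {p q} → a ^ p < a ^ q → p < q
^-cancelˡ-< a {p} {q} lt with p <? q
... | yes p<q = p<q
... | no p≮q = contradiction lt (≤⇒≯ (^-monoʳ-≤ a (≮⇒≥ p≮q)))

module FloorLog (a : ℕ) (1<a : 1 < a) where

  instance
    a≢0 : NonZero a
    a≢0 = >-nonZero (<-trans z<s 1<a)

  log-bracket : ∀ n → ∃[ j ] a ^ j ≤ suc n × suc n < a ^ suc j
  log-bracket zero = 0 , s≤s z≤n , *-monoˡ-≤ 1 1<a
  log-bracket (suc n) with log-bracket n
  ... | j , lower , upper with suc (suc n) <? a ^ suc j
  ...   | yes upper′ = j , m≤n⇒m≤1+n lower , upper′
  ...   | no ¬upper′ =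
    suc j , ≮⇒≥ ¬upper′ , ≤-<-trans upper (^-monoʳ-< a 1<a (n<1+n (suc j)))

  -- ⌊log⌋ 0 = 0 is a junk value; every lemma below assumes 1 ≤ n.
  ⌊log⌋ : ℕ → ℕ
  ⌊log⌋ zero = 0
  ⌊log⌋ (suc n) = proj₁ (log-bracket n)

  ^⌊log⌋≤ : ∀ {n} → 1 ≤ n → a ^ ⌊log⌋ n ≤ n
  ^⌊log⌋≤ {suc n} _ = proj₁ (proj₂ (log-bracket n))

  <^suc⌊log⌋ : ∀ {n} → 1 ≤ n → n < a ^ suc (⌊log⌋ n)
  <^suc⌊log⌋ {suc n} _ = proj₂ (proj₂ (log-bracket n))

  <^⇒⌊log⌋< : ∀ {n q} → 1 ≤ n → n < a ^ q → ⌊log⌋ n < q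
  <^⇒⌊log⌋< 1≤n n<aᵠ = ^-cancelˡ-< a (≤-<-trans (^⌊log⌋≤ 1≤n) n<aᵠ)

  ^≤⇒≤⌊log⌋ : ∀ {p n} → a ^ p ≤ n → p ≤ ⌊log⌋ n
  ^≤⇒≤⌊log⌋ {p} {n} aᵖ≤n =
    s≤s⁻¹ (^-cancelˡ-< a (≤-<-trans aᵖ≤n (<^suc⌊log⌋ 1≤n)))
    where
    1≤n : 1 ≤ n
    1≤n = ≤-trans (m^n>0 a p) aᵖ≤n

  ⌊log⌋-mono-≤ : ∀ {m n} → 1 ≤ m → m ≤ n → ⌊log⌋ m ≤ ⌊log⌋ n
  ⌊log⌋-mono-≤ 1≤m m≤n = ^≤⇒≤⌊log⌋ (≤-trans (^⌊log⌋≤ 1≤m) m≤n)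

  ⌊log⌋[n+d]≤1+⌊log⌋n : ∀ {n d} → 1 ≤ n → d ≤ n → ⌊log⌋ (n + d) ≤ suc (⌊log⌋ n)
  ⌊log⌋[n+d]≤1+⌊log⌋n {n} {d} 1≤n d≤n =
    s≤s⁻¹ (<^⇒⌊log⌋< (≤-trans 1≤n (m≤m+n n d)) n+d<a^[2+L])
    where
    open ≤-Reasoning
    A : ℕ
    A = a ^ suc (⌊log⌋ n)
    n+d<a^[2+L] : n + d < a * A
    n+d<a^[2+L] = begin-strict
      n + d   ≤⟨ +-monoʳ-≤ n d≤n ⟩
      n + n   <⟨ +-mono-< (<^suc⌊log⌋ 1≤n) (<^suc⌊log⌋ 1≤n) ⟩
      A + A   ≡⟨ cong (A +_) (sym (+-identityʳ A)) ⟩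
      2 * A   ≤⟨ *-monoˡ-≤ A 1<a ⟩
      a * A   ∎

module LogColouring (a : ℕ) (1<a : 1 < a) where

  open FloorLog a 1<a

  colouring : Coloring 4
  colouring n = cycle (⌊log⌋ n)

  module MonochromaticProgression
    {m x d : ℕ} (1≤x : 1 ≤ x) (mono : MonoProg colouring (2 + m) a x d) where

    term : ℕ → ℕ
    term i = a * x + i * d

    j : ℕ
    j = ⌊log⌋ (term 1)

    1≤term : ∀ i → 1 ≤ term i
    1≤term i = ≤-trans 1≤x (≤-trans (m≤n*m x a) (m≤m+n (a * x) (i * d)))

    ⌊log⌋-term : ∀ i → i ≤ m → ⌊log⌋ (term (suc i)) ≡ j
    ⌊log⌋-term zero _ = refl
    ⌊log⌋-term (suc i) i<m = begin
      ⌊log⌋ (term (suc (suc i)))  ≡⟨ cong ⌊log⌋ term[2+i]≡n+d ⟩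
      ⌊log⌋ (n + d)               ≡⟨ sym same-block ⟩
      ⌊log⌋ n                     ≡⟨ ⌊log⌋-term i (<⇒≤ i<m) ⟩
      j                           ∎
      where
      open ≡-Reasoning
      n : ℕ
      n = term (suc i)
      term[2+i]≡n+d : term (suc (suc i)) ≡ n + d
      term[2+i]≡n+d =
        trans (cong (a * x +_) (+-comm d (suc i * d))) (sym (+-assoc (a * x) (suc i * d) d))
      d≤n : d ≤ n
      d≤n = ≤-trans (m≤m+n d (i * d)) (m≤n+m (suc i * d) (a * x))
      same-colour : cycle (⌊log⌋ n) ≡ cycle (⌊log⌋ (n + d))
      same-colour = trans (mono (suc i) (s≤s z≤n) (s≤s (s≤s (<⇒≤ i<m))))
        (sym (subst (λ t → cycle (⌊log⌋ t) ≡ cycle (⌊log⌋ x)) term[2+i]≡n+d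
                    (mono (suc (suc i)) (s≤s z≤n) (s≤s (s≤s i<m)))))
      same-block : ⌊log⌋ n ≡ ⌊log⌋ (n + d)
      same-block = cycle-≡⇒≡ (⌊log⌋-mono-≤ (1≤term (suc i)) (m≤m+n n d))
                             (⌊log⌋[n+d]≤1+⌊log⌋n (1≤term (suc i)) d≤n) same-colour

    aʲ≤ax+d : a ^ j ≤ a * x + d
    aʲ≤ax+d = subst (λ e → a ^ j ≤ a * x + e) (*-identityˡ d) (^⌊log⌋≤ (1≤term 1))

    last<a^[1+j] : a * x + suc m * d < a * a ^ j
    last<a^[1+j] = subst (λ L → term (suc m) < a ^ suc L) (⌊log⌋-term m ≤-refl)
                         (<^suc⌊log⌋ (1≤term (suc m)))

    ⌊log⌋x<j : ⌊log⌋ x < j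
    ⌊log⌋x<j = <^⇒⌊log⌋< 1≤x
      (*-cancelˡ-< a x (a ^ j) (≤-<-trans (m≤m+n (a * x) (1 * d)) (<^suc⌊log⌋ (1≤term 1))))

    a²[ax]≤aʲ : a * a * (a * x) ≤ a ^ j
    a²[ax]≤aʲ = begin
      a * a * (a * x)    ≡⟨ *-assoc a a (a * x) ⟩
      a * (a * (a * x))  <⟨ *-monoʳ-< a (*-monoʳ-< a (*-monoʳ-< a (<^suc⌊log⌋ 1≤x))) ⟩
      a ^ (4 + ⌊log⌋ x)  ≤⟨ ^-monoʳ-≤ a 4+⌊log⌋x≤j ⟩
      a ^ j              ∎
      where
      open ≤-Reasoning
      4+⌊log⌋x≤j : 4 + ⌊log⌋ x ≤ j
      4+⌊log⌋x≤j = cycle-≡⇒4+≤ ⌊log⌋x<j (sym (mono 1 (s≤s z≤n) (s≤s (s≤s z≤n))))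

  no-monochromatic : ∀ m → a * a ≤ m * (a + 1) → ¬ HasMonoProg colouring (2 + m) a
  no-monochromatic m a²≤m[a+1] (x , d , 1≤x , _ , mono) =
    <⇒≱ last<a^[1+j] (progression-leaves-block a m a²≤m[a+1] aʲ≤ax+d a²[ax]≤aʲ)
    where open MonochromaticProgression 1≤x mono

theorem4p1 : (a k : ℕ) → 2 ≤ a → 2 ≤ k → a * a ≤ (k ∸ 2) * (a + 1) →
    Σ (Coloring 4) λ c → ¬ HasMonoProg c k a
theorem4p1 a (suc (suc m)) 1<a (s≤s (s≤s z≤n)) a²≤m[a+1] =
  colouring , no-monochromatic m a²≤m[a+1]
  where open LogColouring a 1<a
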